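{- Let $p$ be an odd prime, $m$ even, $M=\mathbb F_{p^m}$, $Q=p^{m/2}$, $1\le k\le m-1$, $r=p^{k+m/2}$, $e=\gcd(k,m)$ with $m/e$ odd, $d=\gcd(k+m/2,m)$, $\mathbb E=\mathbb F_{p^e}$, $\mathbb D=\mathbb F_{p^d}$, $B\in M$ a non-square and $A\in M$ with $AB\in\mathbb F_Q^\times$. Let $f:M\to M$ be semilinear over $\mathbb D$, and suppose that for all $u\in M^\times$ the map $x\mapsto f(x^ru+Axu^r)$ is $\mathbb E$-linear. Then $f=0$.
   Context: One has $e=2d$, so $\mathbb D\subseteq\mathbb E$ with $[\mathbb E:\mathbb D]=2$, and $\mathbb D=\mathbb F_r\cap M$. A map $h:M\to M$ is semilinear over a subfield $K$ if it is additive and there is a field automorphism $\sigma$ of $K$ with $h(\lambda x)=\sigma(\lambda)h(x)$ for all $\lambda\in K$, $x\in M$; it is $K$-linear if $\sigma$ is the identity. -}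

module Defs where

open import Level using (Level; _⊔_)
open import Data.Nat using (ℕ; zero; suc)
import Data.Nat as ℕ
open import Data.Fin using (Fin)
open import Data.Product using (Σ; ∃; _×_; _,_)
open import Relation.Nullary using (¬_)
open import Relation.Binary.PropositionalEquality using (_≡_)
open import Algebra.Bundles using (CommutativeRing)

record Field (c ℓ : Level) : Set (Level.suc (c ⊔ ℓ)) where
  field
    commRing : CommutativeRing c ℓ
  open CommutativeRing commRing public
  field
    0≉1     : ¬ (0# ≈ 1#)
    inverse : ∀ x → ¬ (x ≈ 0#) → Σ Carrier λ y → x * y ≈ 1#

module FieldTheory {c ℓ : Level} (F : Field c ℓ) where
  open Field F

  pow : Carrier → ℕ → Carrier
  pow x zero    = 1#
  pow x (suc n) = x * pow x n

  HasCard : ℕ → Set (c ⊔ ℓ)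
  HasCard N = Σ (Carrier → Fin N) λ φ →
                (∀ x y → x ≈ y → φ x ≡ φ y) ×
                (∀ x y → φ x ≡ φ y → x ≈ y) ×
                (∀ i → Σ Carrier λ x → φ x ≡ i)

  InSub : ℕ → ℕ → Carrier → Set ℓ
  InSub p j x = pow x (p ℕ.^ j) ≈ x

  Additive : (Carrier → Carrier) → Set (c ⊔ ℓ)
  Additive h = (∀ x y → x ≈ y → h x ≈ h y) × (∀ x y → h (x + y) ≈ h x + h y)

  IsSubfieldAut : ℕ → ℕ → (Carrier → Carrier) → Set (c ⊔ ℓ)
  IsSubfieldAut p j σ =
    (∀ x → InSub p j x → InSub p j (σ x)) ×
    (∀ x y → x ≈ y → σ x ≈ σ y) ×
    (∀ x y → InSub p j x → InSub p j y → σ (x + y) ≈ σ x + σ y) ×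
    (∀ x y → InSub p j x → InSub p j y → σ (x * y) ≈ σ x * σ y) ×
    (σ 1# ≈ 1#) ×
    (∀ x y → InSub p j x → InSub p j y → σ x ≈ σ y → x ≈ y) ×
    (∀ y → InSub p j y → Σ Carrier λ x → InSub p j x × σ x ≈ y)

  Semilinear : ℕ → ℕ → (Carrier → Carrier) → Set (c ⊔ ℓ)
  Semilinear p j h = Additive h × Σ (Carrier → Carrier) λ σ →
    IsSubfieldAut p j σ × (∀ λ' x → InSub p j λ' → h (λ' * x) ≈ σ λ' * h x)

  Linear : ℕ → ℕ → (Carrier → Carrier) → Set (c ⊔ ℓ)
  Linear p j h = Additive h × (∀ λ' x → InSub p j λ' → h (λ' * x) ≈ λ' * h x)

  IsSquare : Carrier → Set (c ⊔ ℓ)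
  IsSquare b = Σ Carrier λ y → y * y ≈ b

Odd : ℕ → Set
Odd n = Σ ℕ λ t → n ≡ suc (2 ℕ.* t)

-- Since m/e is odd, 𝔼 contains an ω ≠ 0 with ω^(p^(e/2)) = -ω (a power of a non-square
-- of M), and then also ω^r = -ω. Put f⁺ z = f (ω z) + ω f z and f⁻ z = f (ω z) - ω f z.
-- Replacing x by ω x in the 𝔼-linear map x ↦ f (x^r u + A x u^r) changes the sign of
-- x^r u only, which yields f⁻ (A x u^r) = f⁺ (x^r u). Comparing u = 1 with u = w^r, for
-- some w ≠ w^(r²), shows that f⁻ vanishes on all multiples of A (w - w^(r²)) ≠ 0, so
-- f⁻ = 0, hence f⁺ = 0, and 2 ω f = f⁺ - f⁻ = 0. The elements needed exist because a
-- polynomial x^N - x of degree N < |M| cannot vanish on all of M.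

module Submission where

open import Defs
open import Level using (Level; 0ℓ)
open import Algebra.Bundles using (CommutativeRing; RawRing)
open import Data.Nat as ℕ using (ℕ; zero; suc; _≤_; _<_; z≤n; s≤s)
import Data.Nat.Properties as ℕ
open import Data.Nat.Divisibility using (_∣_)
open import Data.Nat.GCD using (gcd; gcd[m,n]∣m)
open import Data.Nat.Primality using (Prime; prime⇒nonTrivial)
open import Data.Fin as Fin using (Fin; punchIn; punchOut)
import Data.Fin.Properties as Fin
open import Data.Fin.Permutation using (Permutation; permutation)
open import Data.Vec using (Vec; []; _∷_; replicate)
open import Data.Maybe using (Maybe; just; nothing)
open import Data.Product using (Σ; ∃; _×_; _,_; proj₁; proj₂)
import Data.Product.Properties as Product
open import Data.Sum using (_⊎_; inj₁; inj₂)
open import Data.Empty using (⊥-elim)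
open import Function using (_∘_)
open import Relation.Nullary using (¬_; yes; no)
open import Relation.Binary.Definitions using (Decidable; tri<; tri≈; tri>)
import Relation.Binary.PropositionalEquality as ≡
open ≡ using (_≡_)
import Algebra.Properties.CommutativeMonoid.Sum as CommutativeMonoidSum

module CommutativeRingSolver {c ℓ} (R : CommutativeRing c ℓ) where
  open CommutativeRing R
  open import Algebra.Properties.Ring ring
    using (-0#≈0#; -‿involutive; -‿+-comm; -‿distribˡ-*; -‿distribʳ-*)
  open import Algebra.Properties.CommutativeSemigroup +-commutativeSemigroup
    using (interchange)
  open import Algebra.Properties.Semiring.Mult semiring
    using (×-homo-+; ×1-homo-*) renaming (_×_ to _×ᵣ_)
  open import Algebra.Solver.Ring.AlmostCommutativeRing
  open import Relation.Binary.Reasoning.Setoid setoid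

  -- Integer coefficients: (a , b) stands for a - b, and the operations keep one
  -- side zero, so that equal integers are equal pairs.
  ℤ-canonical : ℕ → ℕ → ℕ × ℕ
  ℤ-canonical a b = (a ℕ.∸ b , b ℕ.∸ a)

  _+ℤ_ _*ℤ_ : ℕ × ℕ → ℕ × ℕ → ℕ × ℕ
  (a , b) +ℤ (a′ , b′) = ℤ-canonical (a ℕ.+ a′) (b ℕ.+ b′)
  (a , b) *ℤ (a′ , b′) = ℤ-canonical (a ℕ.* a′ ℕ.+ b ℕ.* b′) (a ℕ.* b′ ℕ.+ b ℕ.* a′)

  -ℤ_ : ℕ × ℕ → ℕ × ℕ
  -ℤ (a , b) = (b , a)

  ℤ-rawRing : RawRing 0ℓ 0ℓ
  ℤ-rawRing = record
    { Carrier = ℕ × ℕ ; _≈_ = ≡._≡_ ; _+_ = _+ℤ_ ; _*_ = _*ℤ_ ; -_ = -ℤ_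
    ; 0# = (0 , 0) ; 1# = (1 , 0) }

  ι : ℕ → Carrier
  ι n = n ×ᵣ 1#

  ⟦_⟧ℤ : ℕ × ℕ → Carrier
  ⟦ a , b ⟧ℤ = ι a - ι b

  x-y+u-v≈x+u-[y+v] : ∀ x y u v → (x - y) + (u - v) ≈ (x + u) - (y + v)
  x-y+u-v≈x+u-[y+v] x y u v =
    trans (interchange x (- y) u (- v)) (+-congˡ (-‿+-comm y v))

  ⟦ℤ-canonical⟧ : ∀ a b → ⟦ ℤ-canonical a b ⟧ℤ ≈ ι a - ι b
  ⟦ℤ-canonical⟧ zero    zero    = refl
  ⟦ℤ-canonical⟧ zero    (suc b) = refl
  ⟦ℤ-canonical⟧ (suc a) zero    = refl
  ⟦ℤ-canonical⟧ (suc a) (suc b) = begin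
    ⟦ ℤ-canonical a b ⟧ℤ      ≈⟨ ⟦ℤ-canonical⟧ a b ⟩
    ι a - ι b                ≈⟨ +-identityˡ _ ⟨
    0# + (ι a - ι b)         ≈⟨ +-congʳ (-‿inverseʳ 1#) ⟨
    (1# - 1#) + (ι a - ι b)  ≈⟨ x-y+u-v≈x+u-[y+v] 1# 1# (ι a) (ι b) ⟩
    (1# + ι a) - (1# + ι b)  ∎

  +-homo : ∀ x y → ⟦ x +ℤ y ⟧ℤ ≈ ⟦ x ⟧ℤ + ⟦ y ⟧ℤ
  +-homo (a , b) (a′ , b′) = begin
    ⟦ ℤ-canonical (a ℕ.+ a′) (b ℕ.+ b′) ⟧ℤ
      ≈⟨ ⟦ℤ-canonical⟧ (a ℕ.+ a′) (b ℕ.+ b′) ⟩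
    ι (a ℕ.+ a′) - ι (b ℕ.+ b′)
      ≈⟨ +-cong (×-homo-+ 1# a a′) (-‿cong (×-homo-+ 1# b b′)) ⟩
    (ι a + ι a′) - (ι b + ι b′)
      ≈⟨ x-y+u-v≈x+u-[y+v] (ι a) (ι b) (ι a′) (ι b′) ⟨
    (ι a - ι b) + (ι a′ - ι b′) ∎

  [x-y]*[u-v] : ∀ x y u v → (x - y) * (u - v) ≈ (x * u + y * v) - (x * v + y * u)
  [x-y]*[u-v] x y u v = begin
    (x - y) * (u - v)                       ≈⟨ distribʳ (u - v) x (- y) ⟩
    x * (u - v) + - y * (u - v)             ≈⟨ +-cong (distribˡ x u (- v)) (distribˡ (- y) u (- v)) ⟩
    (x * u + x * - v) + (- y * u + - y * - v)
      ≈⟨ +-cong (+-congˡ (sym (-‿distribʳ-* x v)))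
                (+-cong (sym (-‿distribˡ-* y u)) -y*-v≈y*v) ⟩
    (x * u - x * v) + (- (y * u) + y * v)   ≈⟨ +-congˡ (+-comm _ _) ⟩
    (x * u - x * v) + (y * v - y * u)       ≈⟨ x-y+u-v≈x+u-[y+v] (x * u) (x * v) (y * v) (y * u) ⟩
    (x * u + y * v) - (x * v + y * u)       ∎
    where
    -y*-v≈y*v : - y * - v ≈ y * v
    -y*-v≈y*v = trans (sym (-‿distribˡ-* y (- v)))
                 (trans (-‿cong (sym (-‿distribʳ-* y v))) (-‿involutive (y * v)))

  *-homo : ∀ x y → ⟦ x *ℤ y ⟧ℤ ≈ ⟦ x ⟧ℤ * ⟦ y ⟧ℤ
  *-homo (a , b) (a′ , b′) = begin
    ⟦ ℤ-canonical (a ℕ.* a′ ℕ.+ b ℕ.* b′) (a ℕ.* b′ ℕ.+ b ℕ.* a′) ⟧ℤ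
      ≈⟨ ⟦ℤ-canonical⟧ (a ℕ.* a′ ℕ.+ b ℕ.* b′) (a ℕ.* b′ ℕ.+ b ℕ.* a′) ⟩
    ι (a ℕ.* a′ ℕ.+ b ℕ.* b′) - ι (a ℕ.* b′ ℕ.+ b ℕ.* a′)
      ≈⟨ +-cong (ι-+* a a′ b b′) (-‿cong (ι-+* a b′ b a′)) ⟩
    (ι a * ι a′ + ι b * ι b′) - (ι a * ι b′ + ι b * ι a′)
      ≈⟨ [x-y]*[u-v] (ι a) (ι b) (ι a′) (ι b′) ⟨
    (ι a - ι b) * (ι a′ - ι b′) ∎
    where
    ι-+* : ∀ m n m′ n′ → ι (m ℕ.* n ℕ.+ m′ ℕ.* n′) ≈ ι m * ι n + ι m′ * ι n′
    ι-+* m n m′ n′ = trans (×-homo-+ 1# (m ℕ.* n) (m′ ℕ.* n′))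
                           (+-cong (×1-homo-* m n) (×1-homo-* m′ n′))

  -‿homo : ∀ x → ⟦ -ℤ x ⟧ℤ ≈ - ⟦ x ⟧ℤ
  -‿homo (a , b) = begin
    ι b - ι a        ≈⟨ +-comm _ _ ⟩
    - ι a + ι b      ≈⟨ +-congˡ (-‿involutive (ι b)) ⟨
    - ι a - - ι b    ≈⟨ -‿+-comm (ι a) (- ι b) ⟩
    - (ι a - ι b)    ∎

  ℤ⟶R : ℤ-rawRing -Raw-AlmostCommutative⟶ fromCommutativeRing R
  ℤ⟶R = record
    { ⟦_⟧    = ⟦_⟧ℤ
    ; +-homo = +-homo
    ; *-homo = *-homo
    ; -‿homo = -‿homo
    ; 0-homo = -‿inverseʳ 0#
    ; 1-homo = trans (+-congˡ -0#≈0#) (trans (+-identityʳ _) (+-identityʳ 1#))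
    }

  -- Sound on all pairs, and complete on the canonical pairs that the solver produces.
  ℤ-equal? : ∀ x y → Maybe (⟦ x ⟧ℤ ≈ ⟦ y ⟧ℤ)
  ℤ-equal? x y with Product.≡-dec ℕ._≟_ ℕ._≟_ x y
  ... | yes ≡.refl = just refl
  ... | no _       = nothing

  open import Algebra.Solver.Ring ℤ-rawRing (fromCommutativeRing R) ℤ⟶R ℤ-equal? public


module Parity where
  open import Data.Nat using (_+_; _*_; _^_)
  open import Data.Nat.Properties using (*-suc; even≢odd)
  open import Data.Nat.Tactic.RingSolver using (solve-∀)
  open import Relation.Binary.PropositionalEquality using (refl; sym; trans; cong)

  even-or-odd : ∀ n → (∃ λ c → n ≡ 2 * c) ⊎ Odd n
  even-or-odd zero = inj₁ (0 , refl)
  even-or-odd (suc n) with even-or-odd n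
  ... | inj₁ (c , n≡2c)   = inj₂ (c , cong suc n≡2c)
  ... | inj₂ (c , n≡1+2c) = inj₁ (suc c , trans (cong suc n≡1+2c) (sym (*-suc 2 c)))

  Odd-* : ∀ {m n} → Odd m → Odd n → Odd (m * n)
  Odd-* (a , refl) (b , refl) = a + b + 2 * a * b , lemma a b
    where
    lemma : ∀ a b → suc (2 * a) * suc (2 * b) ≡ suc (2 * (a + b + 2 * a * b))
    lemma = solve-∀

  Odd-^ : ∀ {m} → Odd m → ∀ n → Odd (m ^ n)
  Odd-^ odd-m zero    = 0 , refl
  Odd-^ odd-m (suc n) = Odd-* odd-m (Odd-^ odd-m n)

  even-if-odd-cofactor : ∀ {m n t} → Odd t → 2 * n ≡ m * t → ∃ λ c → m ≡ 2 * c
  even-if-odd-cofactor {m} {n} odd-t 2n≡mt with even-or-odd m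
  ... | inj₁ even-m = even-m
  ... | inj₂ odd-m  = ⊥-elim (even≢odd n (proj₁ odd-mt) (trans 2n≡mt (proj₂ odd-mt)))
    where odd-mt = Odd-* odd-m odd-t

  -- Powers of an odd square a² = 1 + 4α(α+1) stay ≡ 1 modulo 4α.
  odd-square-^ : ∀ α n → ∃ λ E → (suc (2 * α) * suc (2 * α)) ^ n ≡ suc (2 * (E * (2 * α)))
  odd-square-^ α zero = 0 , refl
  odd-square-^ α (suc n) with odd-square-^ α n
  ... | E , eq = suc α + E + 2 * suc α * E * (2 * α)
               , trans (cong (suc (2 * α) * suc (2 * α) *_) eq) (lemma α E)
    where
    lemma : ∀ α E → suc (2 * α) * suc (2 * α) * suc (2 * (E * (2 * α)))
                  ≡ suc (2 * ((suc α + E + 2 * suc α * E * (2 * α)) * (2 * α)))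
    lemma = solve-∀

open Parity using (Odd-*; Odd-^; even-if-odd-cofactor; odd-square-^)

^-double : ∀ a m → a ℕ.^ (2 ℕ.* m) ≡ (a ℕ.* a) ℕ.^ m
^-double a m =
  ≡.trans (≡.sym (ℕ.^-*-assoc a 2 m)) (≡.cong (λ b → (a ℕ.* b) ℕ.^ m) (ℕ.*-identityʳ a))

module Exponents (p h k : ℕ) (1<p : 1 < p) (odd-p : Odd p) (1≤k : 1 ≤ k) (k<2h : k < 2 ℕ.* h)
                 (t′ : ℕ) (2h≡e*t : 2 ℕ.* h ≡ gcd k (2 ℕ.* h) ℕ.* suc (2 ℕ.* t′)) where

  open import Data.Nat using (_+_; _*_; _^_; _∸_)
  open import Data.Nat.Properties
  open import Data.Nat.Tactic.RingSolver using (solve-∀)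
  open import Relation.Binary.PropositionalEquality
    using (_≢_; refl; sym; trans; cong; subst; module ≡-Reasoning)

  e t q : ℕ
  e = gcd k (2 * h)
  t = suc (2 * t′)
  q = p ^ (2 * h)

  private
    e-even : ∃ λ c → e ≡ 2 * c
    e-even = even-if-odd-cofactor {e} {h} (t′ , refl) 2h≡e*t

    k-multiple : e ∣ k
    k-multiple = gcd[m,n]∣m k (2 * h)

  c k′ : ℕ
  c = proj₁ e-even
  k′ = _∣_.quotient k-multiple

  e≡2c : e ≡ 2 * c
  e≡2c = proj₂ e-even

  k≡k′*e : k ≡ k′ * e
  k≡k′*e = _∣_.equality k-multiple

  h≡c*t : h ≡ c * t
  h≡c*t = *-cancelˡ-≡ h (c * t) 2 (trans 2h≡e*t (trans (cong (_* t) e≡2c) (*-assoc 2 c t)))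

  1≤h : 1 ≤ h
  1≤h = *-cancelˡ-≤ {1} {h} 2 (≤-trans (s≤s 1≤k) k<2h)

  c≢0 : c ≢ 0
  c≢0 c≡0 = <⇒≱ 1≤h (≤-reflexive (trans h≡c*t (cong (_* t) c≡0)))

  k≢h : k ≢ h
  k≢h k≡h = even≢odd k′ t′ (*-cancelˡ-≡ (2 * k′) t c {{ℕ.≢-nonZero c≢0}} (begin
    c * (2 * k′)   ≡⟨ lemma c k′ ⟩
    k′ * (2 * c)   ≡⟨ cong (k′ *_) e≡2c ⟨
    k′ * e         ≡⟨ k≡k′*e ⟨
    k              ≡⟨ k≡h ⟩
    h              ≡⟨ h≡c*t ⟩
    c * t          ∎))
    where
    open ≡-Reasoning
    lemma : ∀ c k′ → c * (2 * k′) ≡ k′ * (2 * c)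
    lemma = solve-∀

  a α : ℕ
  a = p ^ c
  α = proj₁ (Odd-^ odd-p c)

  a≡1+2α : a ≡ suc (2 * α)
  a≡1+2α = proj₂ (Odd-^ odd-p c)

  p^[c*n]≡a^n : ∀ n → p ^ (c * n) ≡ a ^ n
  p^[c*n]≡a^n n = sym (^-*-assoc p c n)

  p^e≡a*a : p ^ e ≡ a * a
  p^e≡a*a = begin
    p ^ e        ≡⟨ cong (p ^_) (trans e≡2c (*-comm 2 c)) ⟩
    p ^ (c * 2)  ≡⟨ p^[c*n]≡a^n 2 ⟩
    a * (a * 1)  ≡⟨ cong (a *_) (*-identityʳ a) ⟩
    a * a        ∎
    where open ≡-Reasoning

  q≡[a*a]^t : q ≡ (a * a) ^ t
  q≡[a*a]^t = begin
    p ^ (2 * h)        ≡⟨ cong (λ n → p ^ (2 * n)) h≡c*t ⟩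
    p ^ (2 * (c * t))  ≡⟨ cong (p ^_) (lemma c t) ⟩
    p ^ (c * (2 * t))  ≡⟨ p^[c*n]≡a^n (2 * t) ⟩
    a ^ (2 * t)        ≡⟨ ^-double a t ⟩
    (a * a) ^ t        ∎
    where
    open ≡-Reasoning
    lemma : ∀ c t → 2 * (c * t) ≡ c * (2 * t)
    lemma = solve-∀

  r≡a*[a*a]^m : ∃ λ m → p ^ (k + h) ≡ a * (a * a) ^ m
  r≡a*[a*a]^m = k′ + t′ , (begin
    p ^ (k + h)                      ≡⟨ cong (λ n → p ^ (n + h)) (trans k≡k′*e (cong (k′ *_) e≡2c)) ⟩
    p ^ (k′ * (2 * c) + h)           ≡⟨ cong (λ n → p ^ (k′ * (2 * c) + n)) h≡c*t ⟩
    p ^ (k′ * (2 * c) + c * t)       ≡⟨ cong (p ^_) (lemma k′ c t′) ⟩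
    p ^ (c * suc (2 * (k′ + t′)))    ≡⟨ p^[c*n]≡a^n (suc (2 * (k′ + t′))) ⟩
    a * a ^ (2 * (k′ + t′))          ≡⟨ cong (a *_) (^-double a (k′ + t′)) ⟩
    a * (a * a) ^ (k′ + t′)          ∎)
    where
    open ≡-Reasoning
    lemma : ∀ k′ c t′ → k′ * (2 * c) + c * suc (2 * t′) ≡ c * suc (2 * (k′ + t′))
    lemma = solve-∀

  1<q : 1 < q
  1<q = ^-monoʳ-< p 1<p {0} {2 * h} (≤-trans (s≤s z≤n) (*-monoʳ-≤ 2 1≤h))

  -- As x^q = x on a field of size q, raising to the power r² acts as raising to N.
  record SquareReduction : Set where
    field
      i N       : ℕ
      1<N       : 1 < N
      N<q       : N < q
      r*r≡q^i*N : p ^ (k + h) * p ^ (k + h) ≡ q ^ i * N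

  private
    square-reduction-from : ∀ i J → 1 ≤ J → J < h →
                            (k + h) + (k + h) ≡ 2 * h * i + 2 * J → SquareReduction
    square-reduction-from i J 1≤J J<h exponent = record
      { i = i ; N = p ^ (2 * J)
      ; 1<N = ^-monoʳ-< p 1<p {0} {2 * J} (≤-trans (s≤s z≤n) (*-monoʳ-≤ 2 1≤J))
      ; N<q = ^-monoʳ-< p 1<p (*-monoʳ-< 2 J<h)
      ; r*r≡q^i*N = begin
          p ^ (k + h) * p ^ (k + h)    ≡⟨ ^-distribˡ-+-* p (k + h) (k + h) ⟨
          p ^ ((k + h) + (k + h))      ≡⟨ cong (p ^_) exponent ⟩
          p ^ (2 * h * i + 2 * J)      ≡⟨ ^-distribˡ-+-* p (2 * h * i) (2 * J) ⟩
          p ^ (2 * h * i) * p ^ (2 * J) ≡⟨ cong (_* p ^ (2 * J)) (^-*-assoc p (2 * h) i) ⟨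
          q ^ i * p ^ (2 * J)          ∎
      }
      where open ≡-Reasoning

  square-reduction : SquareReduction
  square-reduction with <-cmp k h
  ... | tri< k<h _ _ = square-reduction-from 1 k 1≤k k<h (lemma k h)
    where
    lemma : ∀ k h → (k + h) + (k + h) ≡ 2 * h * 1 + 2 * k
    lemma = solve-∀
  ... | tri≈ _ k≡h _ = ⊥-elim (k≢h k≡h)
  ... | tri> _ _ h<k = square-reduction-from 2 J (m<n⇒0<n∸m h<k) J<h
                         (trans (cong (λ n → (n + h) + (n + h)) (sym h+J≡k)) (lemma h J))
    where
    J = k ∸ h
    h+J≡k : h + J ≡ k
    h+J≡k = m+[n∸m]≡n (<⇒≤ h<k)
    J<h : J < h
    J<h = +-cancelˡ-< h J h (subst (_< h + h) (sym h+J≡k) (subst (k <_) (lemma2 h) k<2h))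
      where lemma2 : ∀ h → 2 * h ≡ h + h
            lemma2 = solve-∀
    lemma : ∀ h J → ((h + J) + h) + ((h + J) + h) ≡ 2 * h * 2 + 2 * J
    lemma = solve-∀

module FieldLemmas {c ℓ} (F : Field c ℓ) where
  open Field F
  open FieldTheory F
  open CommutativeRingSolver commRing using (solve; _:+_; _:*_; _:-_; :-_; _:=_)
  open import Algebra.Properties.Ring ring
    using ( -‿distribˡ-*; -‿involutive; x+x≈x⇒x≈0; +-inverseˡ-unique; +-inverseʳ-unique
          ; x∙y⁻¹≈ε⇒x≈y; x≈y⇒x∙y⁻¹≈ε)
  open import Algebra.Properties.CommutativeSemiring.Exp commutativeSemiring
    using (_^_; ^-congˡ; ^-homo-*; ^-assocʳ; ^-distrib-*)
  open import Relation.Binary.Reasoning.Setoid setoid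

  x*y≈0⇒y≈0 : ∀ {x y} → x ≉ 0# → x * y ≈ 0# → y ≈ 0#
  x*y≈0⇒y≈0 {x} {y} x≉0 x*y≈0 with inverse x x≉0
  ... | x⁻¹ , x*x⁻¹≈1 = begin
    y              ≈⟨ *-identityˡ y ⟨
    1# * y         ≈⟨ *-congʳ (trans (*-comm x⁻¹ x) x*x⁻¹≈1) ⟨
    (x⁻¹ * x) * y  ≈⟨ *-assoc x⁻¹ x y ⟩
    x⁻¹ * (x * y)  ≈⟨ *-congˡ x*y≈0 ⟩
    x⁻¹ * 0#       ≈⟨ zeroʳ x⁻¹ ⟩
    0#             ∎

  x≉0∧y≉0⇒x*y≉0 : ∀ {x y} → x ≉ 0# → y ≉ 0# → x * y ≉ 0#
  x≉0∧y≉0⇒x*y≉0 x≉0 y≉0 = y≉0 ∘ x*y≈0⇒y≈0 x≉0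

  x-y≈0⇒x≈y : ∀ {x y} → x - y ≈ 0# → x ≈ y
  x-y≈0⇒x≈y = x∙y⁻¹≈ε⇒x≈y _ _

  pow≡^ : ∀ x n → pow x n ≡ x ^ n
  pow≡^ x zero    = ≡.refl
  pow≡^ x (suc n) = ≡.cong (x *_) (pow≡^ x n)

  pow-cong : ∀ {x y} n → x ≈ y → pow x n ≈ pow y n
  pow-cong {x} {y} n x≈y rewrite pow≡^ x n | pow≡^ y n = ^-congˡ n x≈y

  pow-+ : ∀ x m n → pow x (m ℕ.+ n) ≈ pow x m * pow x n
  pow-+ x m n rewrite pow≡^ x (m ℕ.+ n) | pow≡^ x m | pow≡^ x n = ^-homo-* x m n

  pow-* : ∀ x m n → pow x (m ℕ.* n) ≈ pow (pow x m) n
  pow-* x m n rewrite pow≡^ x (m ℕ.* n) | pow≡^ (pow x m) n | pow≡^ x m = sym (^-assocʳ x m n)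

  pow-distrib-* : ∀ x y n → pow (x * y) n ≈ pow x n * pow y n
  pow-distrib-* x y n rewrite pow≡^ (x * y) n | pow≡^ x n | pow≡^ y n = ^-distrib-* x y n

  pow-1# : ∀ n → pow 1# n ≈ 1#
  pow-1# zero    = refl
  pow-1# (suc n) = trans (*-identityˡ _) (pow-1# n)

  non-fixed⇒≉0 : ∀ {x n} → 1 ≤ n → pow x n ≉ x → x ≉ 0#
  non-fixed⇒≉0 {x} {suc n} _ x^n≉x x≈0 =
    x^n≉x (trans (pow-cong (suc n) x≈0) (trans (zeroˡ _) (sym x≈0)))

  pow-nonzero : ∀ {x} n → x ≉ 0# → pow x n ≉ 0#
  pow-nonzero zero    x≉0 1≈0 = 0≉1 (sym 1≈0)
  pow-nonzero (suc n) x≉0 = x≉0∧y≉0⇒x*y≉0 x≉0 (pow-nonzero n x≉0)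

  pow-neg-odd : ∀ x {n} → Odd n → pow (- x) n ≈ - pow x n
  pow-neg-odd x (t , ≡.refl) = begin
    - x * pow (- x) (2 ℕ.* t)         ≈⟨ *-congˡ (pow-* (- x) 2 t) ⟩
    - x * pow (pow (- x) 2) t         ≈⟨ *-congˡ (pow-cong t (solve 2 (λ x o →
                                           (:- x) :* ((:- x) :* o) := x :* (x :* o)) refl x 1#)) ⟩
    - x * pow (pow x 2) t             ≈⟨ *-congˡ (pow-* x 2 t) ⟨
    - x * pow x (2 ℕ.* t)             ≈⟨ -‿distribˡ-* x _ ⟨
    - (x * pow x (2 ℕ.* t))           ∎

  pow-fixed-^ : ∀ {x m} → pow x m ≈ x → ∀ n → pow x (m ℕ.^ n) ≈ x
  pow-fixed-^ {x} {m} x^m≈x zero    = *-identityʳ x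
  pow-fixed-^ {x} {m} x^m≈x (suc n) = begin
    pow x (m ℕ.* m ℕ.^ n)     ≈⟨ pow-* x m (m ℕ.^ n) ⟩
    pow (pow x m) (m ℕ.^ n)   ≈⟨ pow-cong (m ℕ.^ n) x^m≈x ⟩
    pow x (m ℕ.^ n)           ≈⟨ pow-fixed-^ x^m≈x n ⟩
    x                         ∎

  module AntiFixed {x a} (odd-a : Odd a) (x^a≈-x : pow x a ≈ - x) where

    pow-[a*a]^n : ∀ n → pow x ((a ℕ.* a) ℕ.^ n) ≈ x
    pow-[a*a]^n = pow-fixed-^ (begin
      pow x (a ℕ.* a)     ≈⟨ pow-* x a a ⟩
      pow (pow x a) a     ≈⟨ pow-cong a x^a≈-x ⟩
      pow (- x) a         ≈⟨ pow-neg-odd x odd-a ⟩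
      - pow x a           ≈⟨ -‿cong x^a≈-x ⟩
      - - x               ≈⟨ -‿involutive x ⟩
      x                   ∎)

    pow-a*[a*a]^n : ∀ n → pow x (a ℕ.* (a ℕ.* a) ℕ.^ n) ≈ - x
    pow-a*[a*a]^n n = begin
      pow x (a ℕ.* (a ℕ.* a) ℕ.^ n)    ≈⟨ pow-* x a _ ⟩
      pow (pow x a) ((a ℕ.* a) ℕ.^ n)  ≈⟨ pow-cong ((a ℕ.* a) ℕ.^ n) x^a≈-x ⟩
      pow (- x) ((a ℕ.* a) ℕ.^ n)      ≈⟨ pow-neg-odd x (Odd-^ (Odd-* odd-a odd-a) n) ⟩
      - pow x ((a ℕ.* a) ℕ.^ n)        ≈⟨ -‿cong (pow-[a*a]^n n) ⟩
      - x                              ∎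

  module AdditiveMap {g : Carrier → Carrier} (additive : Additive g) where

    g-cong : ∀ x y → x ≈ y → g x ≈ g y
    g-cong = proj₁ additive

    g-+ : ∀ x y → g (x + y) ≈ g x + g y
    g-+ = proj₂ additive

    g-0 : g 0# ≈ 0#
    g-0 = x+x≈x⇒x≈0 (g 0#) (trans (sym (g-+ 0# 0#)) (g-cong _ _ (+-identityˡ 0#)))

    g-neg : ∀ x → g (- x) ≈ - g x
    g-neg x = +-inverseʳ-unique (g x) (g (- x))
      (trans (sym (g-+ x (- x))) (trans (g-cong _ _ (-‿inverseʳ x)) g-0))

    g-- : ∀ x y → g (x - y) ≈ g x - g y
    g-- x y = trans (g-+ x (- y)) (+-congˡ (g-neg y))

  x*x≈1∧x≉1⇒x≈-1 : ∀ {x} → x * x ≈ 1# → x ≉ 1# → x ≈ - 1#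
  x*x≈1∧x≉1⇒x≈-1 {x} x*x≈1 x≉1 = +-inverseˡ-unique x 1#
    (x*y≈0⇒y≈0 (x≉1 ∘ x-y≈0⇒x≈y) (begin
      (x - 1#) * (x + 1#)  ≈⟨ solve 2 (λ x o → (x :- o) :* (x :+ o) := x :* x :- o :* o) refl x 1# ⟩
      x * x - 1# * 1#      ≈⟨ +-cong x*x≈1 (-‿cong (*-identityˡ 1#)) ⟩
      1# - 1#              ≈⟨ -‿inverseʳ 1# ⟩
      0#                   ∎))

  -- A vector of length d lists the lower coefficients of a monic polynomial of
  -- degree d, in Horner form.
  monic : ∀ {d} → Vec Carrier d → Carrier → Carrier
  monic []       x = 1#
  monic (a ∷ as) x = a + x * monic as x

  deflate : ∀ {d} → Vec Carrier (suc d) → Carrier → Vec Carrier d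
  deflate (a ∷ [])      b = []
  deflate (a ∷ a′ ∷ as) b = monic (a′ ∷ as) b ∷ deflate (a′ ∷ as) b

  monic-deflate : ∀ {d} (as : Vec Carrier (suc d)) b x →
                  monic as x ≈ (x - b) * monic (deflate as b) x + monic as b
  monic-deflate (a ∷ []) b x =
    solve 4 (λ a x b o → a :+ x :* o := (x :- b) :* o :+ (a :+ b :* o)) refl a x b 1#
  monic-deflate (a ∷ a′ ∷ as) b x = begin
    a + x * monic (a′ ∷ as) x       ≈⟨ +-congˡ (*-congˡ (monic-deflate (a′ ∷ as) b x)) ⟩
    a + x * ((x - b) * Q + R)       ≈⟨ solve 5 (λ a x b Q R → a :+ x :* ((x :- b) :* Q :+ R)
                                                := (x :- b) :* (R :+ x :* Q) :+ (a :+ b :* R)) refl a x b Q R ⟩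
    (x - b) * (R + x * Q) + (a + b * R) ∎
    where
    Q = monic (deflate (a′ ∷ as) b) x
    R = monic (a′ ∷ as) b

  roots≤degree : ∀ {m d} (as : Vec Carrier d) (root : Fin m → Carrier) →
                 (∀ i j → root i ≈ root j → i ≡ j) → (∀ i → monic as (root i) ≈ 0#) → m ≤ d
  roots≤degree {zero}          as root injective roots = z≤n
  roots≤degree {suc m} {zero}  [] root injective roots = ⊥-elim (0≉1 (sym (roots Fin.zero)))
  roots≤degree {suc m} {suc d} as root injective roots =
    s≤s (roots≤degree (deflate as b) (root ∘ Fin.suc)
           (λ i j eq → Fin.suc-injective (injective _ _ eq)) deflated-roots)
    where
    b = root Fin.zero
    deflated-roots : ∀ i → monic (deflate as b) (root (Fin.suc i)) ≈ 0#
    deflated-roots i = x*y≈0⇒y≈0 x-b≉0 (begin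
      (x - b) * monic (deflate as b) x                 ≈⟨ +-identityʳ _ ⟨
      (x - b) * monic (deflate as b) x + 0#            ≈⟨ +-congˡ (roots Fin.zero) ⟨
      (x - b) * monic (deflate as b) x + monic as b    ≈⟨ monic-deflate as b x ⟨
      monic as x                                       ≈⟨ roots (Fin.suc i) ⟩
      0#                                               ∎)
      where
      x = root (Fin.suc i)
      x-b≉0 : x - b ≉ 0#
      x-b≉0 x-b≈0 with injective _ _ (x-y≈0⇒x≈y x-b≈0)
      ... | ()

  monic-zeros : ∀ d x → monic (replicate d 0#) x ≈ pow x d
  monic-zeros zero    x = refl
  monic-zeros (suc d) x = trans (+-identityˡ _) (*-congˡ (monic-zeros d x))

  monic-x^[2+N]-x : ∀ N x → monic (0# ∷ - 1# ∷ replicate N 0#) x ≈ pow x (suc (suc N)) - x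
  monic-x^[2+N]-x N x = begin
    0# + x * (- 1# + x * monic (replicate N 0#) x)
      ≈⟨ +-congˡ (*-congˡ (+-congˡ (*-congˡ (monic-zeros N x)))) ⟩
    0# + x * (- 1# + x * pow x N)                   ≈⟨ solve 4 (λ z o x X → z :+ x :* (:- o :+ x :* X)
                                                          := x :* (x :* X) :- x :* o :+ z) refl 0# 1# x (pow x N) ⟩
    x * (x * pow x N) - x * 1# + 0#                 ≈⟨ +-identityʳ _ ⟩
    x * (x * pow x N) - x * 1#                      ≈⟨ +-congˡ (-‿cong (*-identityʳ x)) ⟩
    x * (x * pow x N) - x                           ∎

  module Finite {n} (card : HasCard (suc n)) where

    private
      φ : Carrier → Fin (suc n)
      φ = proj₁ card

      φ-cong : ∀ x y → x ≈ y → φ x ≡ φ y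
      φ-cong = proj₁ (proj₂ card)

      φ-injective : ∀ x y → φ x ≡ φ y → x ≈ y
      φ-injective = proj₁ (proj₂ (proj₂ card))

    element : Fin (suc n) → Carrier
    element i = proj₁ (proj₂ (proj₂ (proj₂ card)) i)

    φ-element : ∀ i → φ (element i) ≡ i
    φ-element i = proj₂ (proj₂ (proj₂ (proj₂ card)) i)

    element-injective : ∀ i j → element i ≈ element j → i ≡ j
    element-injective i j eq =
      ≡.trans (≡.sym (φ-element i)) (≡.trans (φ-cong _ _ eq) (φ-element j))

    _≟_ : Decidable _≈_
    x ≟ y with φ x Fin.≟ φ y
    ... | yes φx≡φy = yes (φ-injective x y φx≡φy)
    ... | no  φx≢φy = no (φx≢φy ∘ φ-cong x y)

    unit : Fin n → Carrier
    unit j = element (punchIn (φ 0#) j)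

    unit-nonzero : ∀ j → unit j ≉ 0#
    unit-nonzero j eq = Fin.punchInᵢ≢i (φ 0#) j (≡.trans (≡.sym (φ-element _)) (φ-cong _ _ eq))

    index : ∀ y → y ≉ 0# → Fin n
    index y y≉0 = punchOut {i = φ 0#} {j = φ y} (λ eq → y≉0 (φ-injective _ _ (≡.sym eq)))

    unit-index : ∀ y y≉0 → unit (index y y≉0) ≈ y
    unit-index y y≉0 = trans (reflexive (≡.cong element (Fin.punchIn-punchOut _)))
                             (φ-injective _ _ (φ-element (φ y)))

    index-unit : ∀ j j≉0 → index (unit j) j≉0 ≡ j
    index-unit j j≉0 = ≡.trans (Fin.punchOut-cong (φ 0#) (φ-element _)) (Fin.punchOut-punchIn (φ 0#))

    index-cong : ∀ {y y′} y≉0 y′≉0 → y ≈ y′ → index y y≉0 ≡ index y′ y′≉0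
    index-cong _ _ y≈y′ = Fin.punchOut-cong (φ 0#) (φ-cong _ _ y≈y′)

    module ∏ = CommutativeMonoidSum *-commutativeMonoid

    ∏-nonzero : ∀ {m} (g : Fin m → Carrier) → (∀ j → g j ≉ 0#) → ∏.sum g ≉ 0#
    ∏-nonzero {zero}  g g≉0 1≈0 = 0≉1 (sym 1≈0)
    ∏-nonzero {suc m} g g≉0 =
      x≉0∧y≉0⇒x*y≉0 (g≉0 Fin.zero) (∏-nonzero (g ∘ Fin.suc) (g≉0 ∘ Fin.suc))

    x*unit≉0 : ∀ {x} → x ≉ 0# → ∀ j → x * unit j ≉ 0#
    x*unit≉0 x≉0 j = x≉0∧y≉0⇒x*y≉0 x≉0 (unit-nonzero j)

    scale : ∀ {x} → x ≉ 0# → Fin n → Fin n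
    scale {x} x≉0 j = index (x * unit j) (x*unit≉0 x≉0 j)

    unit-scale : ∀ {x} x≉0 j → unit (scale {x} x≉0 j) ≈ x * unit j
    unit-scale {x} x≉0 j = unit-index (x * unit j) (x*unit≉0 x≉0 j)

    scale-inverse : ∀ {x x′} x≉0 x′≉0 → x * x′ ≈ 1# → ∀ j →
                    scale {x} x≉0 (scale {x′} x′≉0 j) ≡ j
    scale-inverse {x} {x′} x≉0 x′≉0 x*x′≈1 j = ≡.trans
      (index-cong (x*unit≉0 x≉0 (scale x′≉0 j)) (unit-nonzero j) (begin
        x * unit (scale x′≉0 j)  ≈⟨ *-congˡ (unit-scale x′≉0 j) ⟩
        x * (x′ * unit j)        ≈⟨ *-assoc x x′ (unit j) ⟨
        (x * x′) * unit j        ≈⟨ *-congʳ x*x′≈1 ⟩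
        1# * unit j              ≈⟨ *-identityˡ (unit j) ⟩
        unit j                   ∎))
      (index-unit j (unit-nonzero j))

    -- Lagrange: multiplication by x permutes the nonzero elements, so their
    -- product P satisfies P ≈ xⁿ P.
    pow-card-1 : ∀ {x} → x ≉ 0# → pow x n ≈ 1#
    pow-card-1 {x} x≉0 = x-y≈0⇒x≈y (x*y≈0⇒y≈0 (∏-nonzero unit unit-nonzero) (begin
      P * (pow x n - 1#)      ≈⟨ solve 3 (λ P X o → P :* (X :- o) := X :* P :- P :* o) refl P (pow x n) 1# ⟩
      pow x n * P - P * 1#    ≈⟨ +-cong (sym P≈xⁿP) (-‿cong (*-identityʳ P)) ⟩
      P - P                   ≈⟨ -‿inverseʳ P ⟩
      0#                      ∎))
      where
      x⁻¹ = proj₁ (inverse x x≉0)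
      x*x⁻¹≈1 = proj₂ (inverse x x≉0)
      x⁻¹≉0 : x⁻¹ ≉ 0#
      x⁻¹≉0 x⁻¹≈0 = 0≉1 (trans (sym (trans (*-congˡ x⁻¹≈0) (zeroʳ x))) x*x⁻¹≈1)
      π : Permutation n n
      π = permutation (scale x≉0) (scale x⁻¹≉0)
            (scale-inverse x≉0 x⁻¹≉0 x*x⁻¹≈1)
            (scale-inverse x⁻¹≉0 x≉0 (trans (*-comm x⁻¹ x) x*x⁻¹≈1))
      P = ∏.sum unit
      P≈xⁿP : P ≈ pow x n * P
      P≈xⁿP = begin
        P                                ≈⟨ ∏.sum-permute unit π ⟩
        ∏.sum (unit ∘ scale x≉0)         ≈⟨ ∏.sum-cong-≋ (unit-scale x≉0) ⟩
        ∏.sum (λ j → x * unit j)         ≈⟨ ∏.∑-distrib-+ {n} (λ _ → x) unit ⟩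
        ∏.sum {n} (λ _ → x) * P          ≈⟨ *-congʳ (∏.sum-replicate n) ⟩
        x ^ n * P                        ≡⟨ ≡.cong (_* P) (pow≡^ x n) ⟨
        pow x n * P                      ∎

    pow-card : ∀ x → pow x (suc n) ≈ x
    pow-card x with x ≟ 0#
    ... | yes x≈0 = trans (pow-cong (suc n) x≈0) (trans (zeroˡ _) (sym x≈0))
    ... | no  x≉0 = trans (*-congˡ (pow-card-1 x≉0)) (*-identityʳ x)

    pow-card^i* : ∀ x i m → pow x (suc n ℕ.^ i ℕ.* m) ≈ pow x m
    pow-card^i* x i m = trans (pow-* x (suc n ℕ.^ i) m) (pow-cong m (pow-fixed-^ (pow-card x) i))

    -- x ↦ x^N - x is a polynomial of degree N < suc n, so it cannot vanish everywhere.
    ∃-non-fixed : ∀ {N} → 1 < N → N < suc n → ∃ λ x → pow x N ≉ x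
    ∃-non-fixed {1}           (s≤s ()) _
    ∃-non-fixed {suc (suc N)} _ N<card = element (proj₁ witness) , proj₂ witness
      where
      Fixed : Fin (suc n) → Set ℓ
      Fixed i = pow (element i) (suc (suc N)) ≈ element i
      ¬all-fixed : ¬ (∀ i → Fixed i)
      ¬all-fixed all-fixed = ℕ.<⇒≱ N<card
        (roots≤degree (0# ∷ - 1# ∷ replicate N 0#) element element-injective
          (λ i → trans (monic-x^[2+N]-x N (element i)) (x≈y⇒x∙y⁻¹≈ε (all-fixed i))))
      witness : ∃ λ i → ¬ Fixed i
      witness = Fin.¬∀⟶∃¬ (suc n) Fixed (λ i → pow (element i) (suc (suc N)) ≟ element i) ¬all-fixed

  module TwistedLinear
    {f : Carrier → Carrier} (additive : Additive f) {r : ℕ} {A ω : Carrier}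
    (ω^r≈-ω : pow ω r ≈ - ω)
    (ω-linear : ∀ u → u ≉ 0# → ∀ x →
      f (pow (ω * x) r * u + A * (ω * x) * pow u r) ≈ ω * f (pow x r * u + A * x * pow u r))
    where

    open AdditiveMap additive renaming (g-cong to f-cong; g-+ to f-+; g-0 to f-0; g-neg to f-neg)

    f⁺ f⁻ : Carrier → Carrier
    f⁺ z = f (ω * z) + ω * f z
    f⁻ z = f (ω * z) - ω * f z

    f⁺-cong : ∀ x y → x ≈ y → f⁺ x ≈ f⁺ y
    f⁺-cong x y x≈y = +-cong (f-cong _ _ (*-congˡ x≈y)) (*-congˡ (f-cong x y x≈y))

    f⁻-additive : Additive f⁻
    f⁻-additive = f⁻-cong , f⁻-+
      where
      f⁻-cong : ∀ x y → x ≈ y → f⁻ x ≈ f⁻ y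
      f⁻-cong x y x≈y = +-cong (f-cong _ _ (*-congˡ x≈y)) (-‿cong (*-congˡ (f-cong x y x≈y)))
      f⁻-+ : ∀ x y → f⁻ (x + y) ≈ f⁻ x + f⁻ y
      f⁻-+ x y = begin
        f (ω * (x + y)) - ω * f (x + y)
          ≈⟨ +-cong (trans (f-cong _ _ (distribˡ ω x y)) (f-+ _ _)) (-‿cong (*-congˡ (f-+ x y))) ⟩
        (f (ω * x) + f (ω * y)) - ω * (f x + f y)
          ≈⟨ solve 5 (λ a b w c d → (a :+ b) :- w :* (c :+ d) := (a :- w :* c) :+ (b :- w :* d))
                     refl (f (ω * x)) (f (ω * y)) ω (f x) (f y) ⟩
        f⁻ x + f⁻ y ∎

    open AdditiveMap f⁻-additive renaming (g-cong to f⁻-cong; g-- to f⁻--)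

    -- Replacing x by ωx flips the sign of the first summand x^r u and keeps the second.
    f⁻[A*x*uʳ]≈f⁺[xʳ*u] : ∀ u → u ≉ 0# → ∀ x → f⁻ (A * x * pow u r) ≈ f⁺ (pow x r * u)
    f⁻[A*x*uʳ]≈f⁺[xʳ*u] u u≉0 x = begin
      f (ω * b) - ω * f b
        ≈⟨ solve 4 (λ F₁ F₂ w fb → F₂ :- w :* fb := ((:- F₁) :+ F₂) :+ F₁ :- w :* fb)
                   refl (f (ω * a)) (f (ω * b)) ω (f b) ⟩
      ((- f (ω * a)) + f (ω * b)) + f (ω * a) - ω * f b
        ≈⟨ +-congʳ (+-congʳ linearity) ⟩
      (ω * f a + ω * f b) + f (ω * a) - ω * f b
        ≈⟨ solve 4 (λ F₁ w fa fb → (w :* fa :+ w :* fb) :+ F₁ :- w :* fb := F₁ :+ w :* fa)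
                   refl (f (ω * a)) ω (f a) (f b) ⟩
      f (ω * a) + ω * f a ∎
      where
      a = pow x r * u
      b = A * x * pow u r
      twisted : pow (ω * x) r * u + A * (ω * x) * pow u r ≈ - (ω * a) + ω * b
      twisted = begin
        pow (ω * x) r * u + A * (ω * x) * pow u r
          ≈⟨ +-congʳ (*-congʳ (trans (pow-distrib-* ω x r) (*-congʳ ω^r≈-ω))) ⟩
        (- ω * pow x r) * u + A * (ω * x) * pow u r
          ≈⟨ solve 6 (λ w X u A x U → (:- w :* X) :* u :+ A :* (w :* x) :* U
                                      := :- (w :* (X :* u)) :+ w :* (A :* x :* U))
                     refl ω (pow x r) u A x (pow u r) ⟩
        - (ω * a) + ω * b ∎
      linearity : - f (ω * a) + f (ω * b) ≈ ω * f a + ω * f b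
      linearity = begin
        - f (ω * a) + f (ω * b)                          ≈⟨ trans (f-+ _ _) (+-congʳ (f-neg _)) ⟨
        f (- (ω * a) + ω * b)                            ≈⟨ f-cong _ _ twisted ⟨
        f (pow (ω * x) r * u + A * (ω * x) * pow u r)    ≈⟨ ω-linear u u≉0 x ⟩
        ω * f (a + b)                                    ≈⟨ trans (*-congˡ (f-+ a b)) (distribˡ _ _ _) ⟩
        ω * f a + ω * f b                                ∎

    -- Both w and W = w^(r²) give f⁻(A v w) ≈ f⁺(v^r w^r), so f⁻ vanishes on
    -- multiples of A (w - W) ≉ 0, i.e. everywhere.
    f⁻≈0 : A ≉ 0# → ∀ {w} → w ≉ 0# → pow (pow w r) r ≉ w → ∀ z → f⁻ z ≈ 0#
    f⁻≈0 A≉0 {w} w≉0 W≉w z = begin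
      f⁻ z                                  ≈⟨ f⁻-cong _ _ z≈ ⟩
      f⁻ (A * v * w - A * v * W)            ≈⟨ f⁻-- _ _ ⟩
      f⁻ (A * v * w) - f⁻ (A * v * W)       ≈⟨ +-congʳ (f⁻[A*v*w]≈f⁻[A*v*W] v) ⟩
      f⁻ (A * v * W) - f⁻ (A * v * W)       ≈⟨ -‿inverseʳ _ ⟩
      0#                                    ∎
      where
      W = pow (pow w r) r
      d = A * (w - W)
      d≉0 : d ≉ 0#
      d≉0 = x≉0∧y≉0⇒x*y≉0 A≉0 (λ w-W≈0 → W≉w (sym (x-y≈0⇒x≈y w-W≈0)))
      d⁻¹ = proj₁ (inverse d d≉0)
      v = z * d⁻¹
      z≈ : z ≈ A * v * w - A * v * W
      z≈ = begin
        z                    ≈⟨ *-identityʳ z ⟨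
        z * 1#               ≈⟨ *-congˡ (proj₂ (inverse d d≉0)) ⟨
        z * (d * d⁻¹)        ≈⟨ solve 5 (λ z d⁻¹ A w W → z :* ((A :* (w :- W)) :* d⁻¹)
                                      := A :* (z :* d⁻¹) :* w :- A :* (z :* d⁻¹) :* W) refl z d⁻¹ A w W ⟩
        A * v * w - A * v * W ∎
      f⁻[A*v*w]≈f⁻[A*v*W] : ∀ v → f⁻ (A * v * w) ≈ f⁻ (A * v * W)
      f⁻[A*v*w]≈f⁻[A*v*W] v = begin
        f⁻ (A * v * w)                   ≈⟨ f⁻-cong _ _ (trans (*-assoc A v w)
                                              (trans (sym (*-identityʳ _)) (*-congˡ (sym (pow-1# r))))) ⟩
        f⁻ (A * (v * w) * pow 1# r)      ≈⟨ f⁻[A*x*uʳ]≈f⁺[xʳ*u] 1# (0≉1 ∘ sym) (v * w) ⟩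
        f⁺ (pow (v * w) r * 1#)          ≈⟨ f⁺-cong _ _ (trans (*-identityʳ _) (pow-distrib-* v w r)) ⟩
        f⁺ (pow v r * pow w r)           ≈⟨ f⁻[A*x*uʳ]≈f⁺[xʳ*u] (pow w r) (pow-nonzero r w≉0) v ⟨
        f⁻ (A * v * W)                   ∎

    f⁺≈0 : Decidable _≈_ → (∀ z → f⁻ z ≈ 0#) → ∀ z → f⁺ z ≈ 0#
    f⁺≈0 _≟_ f⁻-vanishes z with z ≟ 0#
    ... | yes z≈0 = begin
      f⁺ z                  ≈⟨ f⁺-cong _ _ z≈0 ⟩
      f (ω * 0#) + ω * f 0# ≈⟨ +-cong (trans (f-cong _ _ (zeroʳ ω)) f-0)
                                      (trans (*-congˡ f-0) (zeroʳ ω)) ⟩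
      0# + 0#               ≈⟨ +-identityʳ 0# ⟩
      0#                    ∎
    ... | no  z≉0 = begin
      f⁺ z                     ≈⟨ f⁺-cong _ _ (trans (*-congʳ (pow-1# r)) (*-identityˡ z)) ⟨
      f⁺ (pow 1# r * z)        ≈⟨ f⁻[A*x*uʳ]≈f⁺[xʳ*u] z z≉0 1# ⟨
      f⁻ (A * 1# * pow z r)    ≈⟨ f⁻-vanishes _ ⟩
      0#                       ∎

    f≈0 : Decidable _≈_ → 1# + 1# ≉ 0# → ω ≉ 0# → A ≉ 0# →
          ∀ {w} → w ≉ 0# → pow (pow w r) r ≉ w → ∀ z → f z ≈ 0#
    f≈0 _≟_ 2≉0 ω≉0 A≉0 w≉0 W≉w z = x*y≈0⇒y≈0 2≉0 (x*y≈0⇒y≈0 ω≉0 (begin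
      ω * ((1# + 1#) * f z)
        ≈⟨ *-congˡ (trans (distribʳ _ _ _) (+-cong (*-identityˡ _) (*-identityˡ _))) ⟩
      ω * (f z + f z)
        ≈⟨ solve 3 (λ w fz F → w :* (fz :+ fz) := (F :+ w :* fz) :- (F :- w :* fz))
                   refl ω (f z) (f (ω * z)) ⟩
      f⁺ z - f⁻ z             ≈⟨ +-cong (f⁺≈0 _≟_ f⁻-vanishes z) (-‿cong (f⁻-vanishes z)) ⟩
      0# - 0#                 ≈⟨ -‿inverseʳ 0# ⟩
      0#                      ∎))
      where
      f⁻-vanishes : ∀ z → f⁻ z ≈ 0#
      f⁻-vanishes = f⁻≈0 A≉0 w≉0 W≉w

module Witnesses {c ℓ} (p h k : ℕ) (1<p : 1 < p) (odd-p : Odd p) (1≤k : 1 ≤ k) (k<2h : k < 2 ℕ.* h)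
                 (t′ : ℕ) (2h≡e*t : 2 ℕ.* h ≡ gcd k (2 ℕ.* h) ℕ.* suc (2 ℕ.* t′))
                 (M : Field c ℓ) (card : FieldTheory.HasCard M (p ℕ.^ (2 ℕ.* h))) where

  open Field M
  open FieldTheory M
  open FieldLemmas M
  open Exponents p h k 1<p odd-p 1≤k k<2h t′ 2h≡e*t
  open import Algebra.Properties.Ring ring using (+-inverseˡ-unique; -‿distribʳ-*)
  open import Relation.Binary.Reasoning.Setoid setoid

  private
    E H : ℕ
    E = proj₁ (odd-square-^ α t)
    H = E ℕ.* (2 ℕ.* α)

    q≡1+2H : q ≡ suc (2 ℕ.* H)
    q≡1+2H = ≡.trans q≡[a*a]^t
      (≡.trans (≡.cong (λ b → (b ℕ.* b) ℕ.^ t) a≡1+2α) (proj₂ (odd-square-^ α t)))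

    1≤H : 1 ≤ H
    1≤H = ℕ.n≢0⇒n>0 λ H≡0 →
      ℕ.<-irrefl (≡.sym (≡.trans q≡1+2H (≡.cong (λ m → suc (2 ℕ.* m)) H≡0))) 1<q

    card′ : HasCard (suc (2 ℕ.* H))
    card′ = ≡.subst HasCard q≡1+2H card

  open Finite card′ public using (_≟_)
  open Finite card′ hiding (_≟_)

  private
    y-witness : ∃ λ y → pow y (suc H) ≉ y
    y-witness = ∃-non-fixed (s≤s 1≤H)
      (s≤s (ℕ.m<m+n H (ℕ.≤-trans 1≤H (ℕ.≤-reflexive (≡.sym (ℕ.+-identityʳ H))))))

    y : Carrier
    y = proj₁ y-witness

    y≉0 : y ≉ 0#
    y≉0 = non-fixed⇒≉0 {n = suc H} (s≤s z≤n) (proj₂ y-witness)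

    y^H≉1 : pow y H ≉ 1#
    y^H≉1 y^H≈1 = proj₂ y-witness (trans (*-congˡ y^H≈1) (*-identityʳ y))

    y^H≈-1 : pow y H ≈ - 1#
    y^H≈-1 = x*x≈1∧x≉1⇒x≈-1 (begin
      pow y H * pow y H   ≈⟨ pow-+ y H H ⟨
      pow y (H ℕ.+ H)     ≡⟨ ≡.cong (λ m → pow y (H ℕ.+ m)) (ℕ.+-identityʳ H) ⟨
      pow y (2 ℕ.* H)     ≈⟨ pow-card-1 y≉0 ⟩
      1#                  ∎) y^H≉1

  1+1≉0 : 1# + 1# ≉ 0#
  1+1≉0 2≈0 = y^H≉1 (trans y^H≈-1 (sym (+-inverseˡ-unique 1# 1# 2≈0)))

  -- H = E (a - 1), so ω^(a - 1) = y^H = -1.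
  ω : Carrier
  ω = pow y E

  ω≉0 : ω ≉ 0#
  ω≉0 = pow-nonzero E y≉0

  private
    ω^a≈-ω : pow ω a ≈ - ω
    ω^a≈-ω = begin
      pow ω a               ≡⟨ ≡.cong (pow ω) a≡1+2α ⟩
      ω * pow ω (2 ℕ.* α)   ≈⟨ *-congˡ (pow-* y E (2 ℕ.* α)) ⟨
      ω * pow y H           ≈⟨ *-congˡ y^H≈-1 ⟩
      ω * - 1#              ≈⟨ -‿distribʳ-* ω 1# ⟨
      - (ω * 1#)            ≈⟨ -‿cong (*-identityʳ ω) ⟩
      - ω                   ∎

    open AntiFixed (α , a≡1+2α) ω^a≈-ω

  ω^[p^e]≈ω : pow ω (p ℕ.^ e) ≈ ω
  ω^[p^e]≈ω = begin
    pow ω (p ℕ.^ e)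
      ≡⟨ ≡.cong (pow ω) (≡.trans p^e≡a*a (≡.sym (ℕ.*-identityʳ (a ℕ.* a)))) ⟩
    pow ω ((a ℕ.* a) ℕ.^ 1)    ≈⟨ pow-[a*a]^n 1 ⟩
    ω                          ∎

  ω^r≈-ω : pow ω (p ℕ.^ (k ℕ.+ h)) ≈ - ω
  ω^r≈-ω = trans (reflexive (≡.cong (pow ω) (proj₂ r≡a*[a*a]^m))) (pow-a*[a*a]^n (proj₁ r≡a*[a*a]^m))

  private
    r : ℕ
    r = p ℕ.^ (k ℕ.+ h)

    open SquareReduction square-reduction

    w-witness : ∃ λ w → pow w N ≉ w
    w-witness = ∃-non-fixed 1<N (≡.subst (N <_) q≡1+2H N<q)

  w : Carrier
  w = proj₁ w-witness

  w≉0 : w ≉ 0#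
  w≉0 = non-fixed⇒≉0 (ℕ.<⇒≤ 1<N) (proj₂ w-witness)

  [w^r]^r≉w : pow (pow w r) r ≉ w
  [w^r]^r≉w [w^r]^r≈w = proj₂ w-witness (trans (sym [w^r]^r≈w^N) [w^r]^r≈w)
    where
    [w^r]^r≈w^N : pow (pow w r) r ≈ pow w N
    [w^r]^r≈w^N = begin
      pow (pow w r) r                          ≈⟨ pow-* w r r ⟨
      pow w (r ℕ.* r)
        ≡⟨ ≡.cong (pow w) (≡.trans r*r≡q^i*N (≡.cong (λ m → m ℕ.^ i ℕ.* N) q≡1+2H)) ⟩
      pow w (suc (2 ℕ.* H) ℕ.^ i ℕ.* N)        ≈⟨ pow-card^i* w i N ⟩
      pow w N                                  ∎

lemma4p5 : ∀ {c ℓ : Level} (p h k : ℕ) → Prime p → Odd p →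
    1 ≤ k → k < 2 ℕ.* h →
    Σ ℕ (λ t → (2 ℕ.* h ≡ gcd k (2 ℕ.* h) ℕ.* t) × Odd t) →
    ∀ (M : Field c ℓ) → let open Field M in let open FieldTheory M in
    HasCard (p ℕ.^ (2 ℕ.* h)) →
    ∀ (A B : Carrier) → ¬ IsSquare B →
    InSub p h (A * B) → ¬ (A * B ≈ 0#) →
    ∀ (f : Carrier → Carrier) → Semilinear p (gcd (k ℕ.+ h) (2 ℕ.* h)) f →
    (∀ u → ¬ (u ≈ 0#) →
      Linear p (gcd k (2 ℕ.* h))
        (λ x → f (pow x (p ℕ.^ (k ℕ.+ h)) * u + A * x * pow u (p ℕ.^ (k ℕ.+ h))))) →
    ∀ x → f x ≈ 0#
lemma4p5 p h k prime-p odd-p 1≤k k<2h (_ , 2h≡e*t , t′ , ≡.refl) M card A B _ _ AB≉0 f semilinear linear =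
  f≈0 _≟_ 1+1≉0 ω≉0 A≉0 w≉0 [w^r]^r≉w
  where
  open Field M
  open FieldLemmas M
  1<p : 1 < p
  1<p = ℕ.nonTrivial⇒n>1 p {{prime⇒nonTrivial prime-p}}
  open Witnesses p h k 1<p odd-p 1≤k k<2h t′ 2h≡e*t M card
  A≉0 : A ≉ 0#
  A≉0 A≈0 = AB≉0 (trans (*-congʳ A≈0) (zeroˡ B))
  open TwistedLinear (proj₁ semilinear) {r = p ℕ.^ (k ℕ.+ h)} ω^r≈-ω
    (λ u u≉0 x → proj₂ (linear u u≉0) ω x ω^[p^e]≈ω)
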